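{- Let $r$ be a maximal repetition of a word $w$ and let $\sigma$ be its principal repeat. Suppose $\sigma$ is periodic. Then there is no maximal repetition $r^*\ne r$ of $w$ such that $\sigma$ is represented by $r^*$.
   Context: $w$ has length $n$. For a factor $w[i..j]$ we write $\mathrm{beg}=i$ and $\mathrm{end}=j$. A period of a word $x$ is any $p$ with $x[i]=x[i+p]$ for all valid $i$; $p(x)$ is the minimal period and $e(x)=|x|/p(x)$. A maximal repetition is a factor $r$ with $e(r)\ge2$ satisfying two conditions: if $\mathrm{beg}(r)>1$ then $w[\mathrm{beg}(r)-1]\ne w[\mathrm{beg}(r)+p(r)-1]$, and if $\mathrm{end}(r)<n$ then $w[\mathrm{end}(r)-p(r)+1]\ne w[\mathrm{end}(r)+1]$. Every factor $x$ with $e(x)\ge2$ lies in a unique maximal repetition with the same minimal period. The principal repeat of $r$ is the pair of equal factors $u'=w[\mathrm{beg}(r)..\mathrm{end}(r)-p(r)]$ and $u''=w[\mathrm{beg}(r)+p(r)..\mathrm{end}(r)]$. A repeat $(u',u'')$ with copy length $c=|u'|$ is periodic if its copies are repetitions whose minimal period $q$ satisfies $q\le c/3$. A periodic repeat $(u',u'')$ is represented by a maximal repetition $r^*$ if $r^*$ is the maximal repetition with minimal period $q$ containing $u'$ and also the one containing $u''$. -}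

module Defs where

open import Data.Nat using (ℕ; zero; suc; _+_; _*_; _∸_; _≤_; _<_)
open import Data.Product using (Σ; _×_; _,_)
open import Relation.Binary.PropositionalEquality using (_≡_; _≢_)
open import Relation.Nullary using (¬_)

-- A word of length n over an alphabet A is given by its letters
-- w 0, w 1, …, w (n ∸ 1) (0-indexed; the paper's w[k] is our w (k ∸ 1)).
-- We represent it as a function w : ℕ → A together with its length n; every
-- definition below only inspects positions < n, so values beyond n are irrelevant.
-- A factor w[i..j] (0-indexed, inclusive, i ≤ j < n) is given by the pair (i , j).

len : ℕ → ℕ → ℕ
len i j = suc j ∸ i

IsPeriod : {A : Set} → (ℕ → A) → ℕ → ℕ → ℕ → Set
IsPeriod w i j p =
  (1 ≤ p) × (p ≤ len i j) × (∀ k → i ≤ k → k + p ≤ j → w k ≡ w (k + p))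

IsMinPeriod : {A : Set} → (ℕ → A) → ℕ → ℕ → ℕ → Set
IsMinPeriod w i j p = IsPeriod w i j p × (∀ q → q < p → ¬ IsPeriod w i j q)

IsFactor : ℕ → ℕ → ℕ → Set
IsFactor n i j = (i ≤ j) × (j < n)

IsRepetition : {A : Set} → (ℕ → A) → ℕ → ℕ → ℕ → Set
IsRepetition w i j p = IsMinPeriod w i j p × (2 * p ≤ len i j)

-- r = w[i..j] is a maximal repetition of the word (w, n) with minimal period p(r) = p.
-- (beg(r) > 1 ⇒ w[beg-1] ≠ w[beg+p-1];  end(r) < n ⇒ w[end-p+1] ≠ w[end+1],
--  translated to 0-indexing.)
IsMaxRep : {A : Set} → (ℕ → A) → ℕ → ℕ → ℕ → ℕ → Set
IsMaxRep w n i j p =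
  IsFactor n i j × IsRepetition w i j p
  × (1 ≤ i → w (i ∸ 1) ≢ w (i ∸ 1 + p))
  × (suc j < n → w (suc j ∸ p) ≢ w (suc j))

-- A repeat: a pair of (equal) factors u' = w[i₁..j₁], u'' = w[i₂..j₂].
IsPeriodicRepeatWith : {A : Set} → (ℕ → A) → ℕ → ℕ → ℕ → ℕ → ℕ → Set
IsPeriodicRepeatWith w i₁ j₁ i₂ j₂ q =
  IsRepetition w i₁ j₁ q × IsRepetition w i₂ j₂ q × (3 * q ≤ len i₁ j₁)

IsPeriodicRepeat : {A : Set} → (ℕ → A) → ℕ → ℕ → ℕ → ℕ → Set
IsPeriodicRepeat w i₁ j₁ i₂ j₂ = Σ ℕ (IsPeriodicRepeatWith w i₁ j₁ i₂ j₂)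

Contains : ℕ → ℕ → ℕ → ℕ → Set
Contains a b i j = (a ≤ i) × (j ≤ b)

RepresentedBy : {A : Set} → (ℕ → A) → ℕ → ℕ → ℕ → ℕ → ℕ → ℕ → ℕ → Set
RepresentedBy w n i₁ j₁ i₂ j₂ a b =
  Σ ℕ λ q → IsPeriodicRepeatWith w i₁ j₁ i₂ j₂ q
          × IsMaxRep w n a b q × Contains a b i₁ j₁ × Contains a b i₂ j₂

-- Let σ be represented by r* with period q. The first copy u' of σ has length
-- |r| − p ≥ p and inherits the period p of r, so p(u') = q ≤ p; conversely r lies
-- inside r*, so q is a period of r and p ≤ q. Hence r* has the same period p as r
-- and contains r, and the maximality of r forbids r* from sticking out on either side.
module Submission where

open import Defs
open import Data.Nat using (ℕ; zero; suc; _+_; _*_; _∸_; _≤_; _<_; z≤n; s≤s; s≤s⁻¹; _≤?_)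
open import Data.Nat.Properties
open import Data.Product using (Σ; _×_; _,_)
open import Relation.Binary.PropositionalEquality
  using (_≡_; _≢_; refl; sym; cong; subst; module ≡-Reasoning)
open import Relation.Nullary using (¬_; yes; no; contradiction)

private variable
  A : Set
  w : ℕ → A
  n a b i j p q : ℕ

len-∸ : p ≤ j → len i (j ∸ p) ≡ len i j ∸ p
len-∸ {p} {j} {i} p≤j = begin
  suc (j ∸ p) ∸ i   ≡⟨ cong (_∸ i) (sym (+-∸-assoc 1 p≤j)) ⟩
  suc j ∸ p ∸ i     ≡⟨ ∸-+-assoc (suc j) p i ⟩
  suc j ∸ (p + i)   ≡⟨ cong (suc j ∸_) (+-comm p i) ⟩
  suc j ∸ (i + p)   ≡⟨ sym (∸-+-assoc (suc j) i p) ⟩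
  suc j ∸ i ∸ p     ∎
  where open ≡-Reasoning

period+beg≤ : i ≤ j → p ≤ len i j → p + i ≤ suc j
period+beg≤ {i} {j} {p} i≤j = m≤o∸n⇒m+n≤o p (m≤n⇒m≤1+n i≤j)

period≤len-principalCopy : 1 ≤ p → i ≤ j → 2 * p ≤ len i j → p ≤ len i (j ∸ p)
period≤len-principalCopy {p} {i} {j} 1≤p i≤j 2p≤len =
  subst (p ≤_) (sym (len-∸ {i = i} p≤j)) (m+n≤o⇒m≤o∸n p p+p≤len)
  where
  p+p≤len : p + p ≤ len i j
  p+p≤len = subst (_≤ len i j) (cong (p +_) (+-identityʳ p)) 2p≤len

  p≤j : p ≤ j
  p≤j = s≤s⁻¹ (begin
    suc p   ≡⟨ +-comm 1 p ⟩
    p + 1   ≤⟨ +-monoʳ-≤ p 1≤p ⟩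
    p + p   ≤⟨ m+n≤o⇒m≤o (p + p) (period+beg≤ i≤j p+p≤len) ⟩
    suc j   ∎)
    where open ≤-Reasoning

isPeriod-restrict : IsPeriod w a b q → Contains a b i j → q ≤ len i j → IsPeriod w i j q
isPeriod-restrict (1≤q , _ , per) (a≤i , j≤b) q≤len =
  1≤q , q≤len , λ k i≤k k+q≤j → per k (≤-trans a≤i i≤k) (≤-trans k+q≤j j≤b)

minPeriod≤period : IsMinPeriod w i j p → IsPeriod w i j q → p ≤ q
minPeriod≤period (_ , minimal) per = ≮⇒≥ (λ q<p → minimal _ q<p per)

maxRep-beg : (1 ≤ i → w (i ∸ 1) ≢ w (i ∸ 1 + p))
  → IsPeriod w a b p → a ≤ i → p + i ≤ suc b → a ≡ i
maxRep-beg {i = zero} _ _ a≤0 _ = n≤0⇒n≡0 a≤0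
maxRep-beg {i = suc i} {p = p} {a = a} {b} leftMax (_ , _ , per) a≤1+i p+1+i≤1+b
  with a ≤? i
... | yes a≤i = contradiction (per i a≤i i+p≤b) (leftMax (s≤s z≤n))
  where
  i+p≤b : i + p ≤ b
  i+p≤b = s≤s⁻¹ (subst (_≤ suc b) (+-comm p (suc i)) p+1+i≤1+b)
... | no a≰i = ≤-antisym a≤1+i (≰⇒> a≰i)

maxRep-end : (suc j < n → w (suc j ∸ p) ≢ w (suc j))
  → IsPeriod w a b p → j ≤ b → b < n → p + a ≤ suc j → b ≡ j
maxRep-end {j} {w = w} {p = p} {a = a} {b} rightMax (_ , _ , per) j≤b b<n p+a≤1+j
  with b ≤? j
... | yes b≤j = ≤-antisym b≤j j≤b
... | no b≰j = contradiction (subst (λ x → w (suc j ∸ p) ≡ w x) back≡ period-step)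
                             (rightMax (≤-trans (s≤s (≰⇒> b≰j)) b<n))
  where
  back≡ : suc j ∸ p + p ≡ suc j
  back≡ = m∸n+n≡m (m+n≤o⇒m≤o p p+a≤1+j)

  period-step : w (suc j ∸ p) ≡ w (suc j ∸ p + p)
  period-step = per (suc j ∸ p)
    (m+n≤o⇒m≤o∸n a (subst (_≤ suc j) (+-comm p a) p+a≤1+j))
    (subst (_≤ b) (sym back≡) (≰⇒> b≰j))

maxRep-unextendable : IsMaxRep w n i j p → IsPeriod w a b p → Contains a b i j → b < n
  → (a , b) ≡ (i , j)
maxRep-unextendable ((i≤j , _) , (((_ , p≤len , _) , _) , _) , leftMax , rightMax)
                    perAB (a≤i , j≤b) b<n
  with maxRep-beg leftMax perAB a≤i (≤-trans (period+beg≤ i≤j p≤len) (s≤s j≤b))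
... | refl with maxRep-end rightMax perAB j≤b b<n (period+beg≤ i≤j p≤len)
... | refl = refl

proposition20 : {A : Set} (n : ℕ) (w : ℕ → A) (i j p : ℕ)
    → IsMaxRep w n i j p
    → IsPeriodicRepeat w i (j ∸ p) (i + p) j
    → ¬ (Σ ℕ λ a → Σ ℕ λ b →
    ((a , b) ≢ (i , j)) × RepresentedBy w n i (j ∸ p) (i + p) j a b)
-- RepresentedBy already carries the periodicity of σ.
proposition20 n w i j p maxRep@((i≤j , _) , (minR@(perR@(1≤p , _) , _) , 2p≤len) , _) _
  (a , b , r*≢r , q , ((minU'@((_ , q≤lenU' , _) , _) , _) , _ , _) ,
   ((_ , b<n) , ((per* , _) , _) , _) , (a≤i , _) , (_ , j≤b))
  = r*≢r (maxRep-unextendable maxRep (subst (IsPeriod w a b) q≡p per*) (a≤i , j≤b) b<n)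
  where
  perU' : IsPeriod w i (j ∸ p) p
  perU' = isPeriod-restrict perR (≤-refl , m∸n≤m j p)
            (period≤len-principalCopy 1≤p i≤j 2p≤len)

  perR-q : IsPeriod w i j q
  perR-q = isPeriod-restrict per* (a≤i , j≤b)
             (≤-trans q≤lenU' (∸-monoˡ-≤ i (s≤s (m∸n≤m j p))))

  q≡p : q ≡ p
  q≡p = ≤-antisym (minPeriod≤period minU' perU') (minPeriod≤period minR perR-q)
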